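{- In the game graph $G'_{\phi,K,C}$ with state set $S=S_1\uplus S_2$ and edge set $E$, if $L\subseteq S$ is closed for $\preceq$, then $\mathsf{CPre}_1(L)=\{s\in S_1\mid\exists (s,s')\in E,\ s'\in L\}$ and $\mathsf{CPre}_2(L)=\{s\in S_2\mid\forall (s,s')\in E,\ s'\in L\}$ are also closed for $\preceq$.
   Context: Let $P=I\uplus O$, $\Sigma_P=2^P$, $\Sigma_I=2^I$, $\Sigma_O=2^O$, let $w:\mathrm{Lit}(P)\to\mathbb{Z}$ be a weight function extended to $\Sigma_I$ by $w(i)=\sum_{p\in i}w(p)+\sum_{p\in I\setminus i}w(\neg p)$ and similarly to $\Sigma_O$. Let $\mathcal A=(\Sigma_P,Q,q_0,\alpha,\delta)$ be an automaton ($\delta:Q\times\Sigma_P\to2^Q$) and $K,C\in\mathbb{N}$. $\mathcal K=\{ -1,0,\dots,K,\top\}$ ($\top>K$); $\mathcal F$ is the set of maps $Q\to\mathcal K$, ordered pointwise; $F_0(q)=-1$ for $q\ne q_0$, $F_0(q_0)=1$ if $q_0\in\alpha$ else $0$; $\Delta(F,\sigma)(q)=\max\{F(p)\oplus[q\in\alpha]\mid q\in\delta(p,\sigma)\}$ (max of empty set $=-1$), with $k\oplus b=-1$ if $k=-1$, $k+b$ if $k\notin\{ -1,\top\}$ and $k+b\le K$, $\top$ otherwise. $\mathcal C=\{\bot,0,\dots,C\}$ with $\bot<0$, and $c\oplus k=\min(C,c+k)$ if $c\ne\bot$ and $c+k\ge0$, else $\bot$. $G'_{\phi,K,C}$ has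 Player-1 states $S_1=\{(F,i,c)\mid F\in\mathcal F,i\in\Sigma_I,c\in\mathcal C\}$ and Player-2 states $S_2=\{(F,o,c)\mid F\in\mathcal F,o\in\Sigma_O,c\in\mathcal C\}$ (treated as disjoint), initial state $(F_0,j_0,C)$ for a fixed $j_0\in\Sigma_I$, and edges $((F,j,c),(F,o,c\oplus w(o)))$ and $((F,o,c),(\Delta(F,o\cup i),i,c\oplus w(i)))$ for all $F,j,c,o,i$. The partial order $\preceq$ on $S$: $(F',\sigma,c')\preceq(F,\sigma,c)$ iff both states are in the same part ($S_1$ or $S_2$) with the same middle component $\sigma$, $F'\le F$ pointwise, and $c'\ge c$. A set $L\subseteq S$ is closed for $\preceq$ if whenever $s\in L$ and $s'\preceq s$, then $s'\in L$. -}

module Defs where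

open import Data.Nat as ℕ using (ℕ; zero; suc)
open import Data.Integer as ℤ using (ℤ; +_; -[1+_])
open import Data.Fin as Fin using (Fin; toℕ; fromℕ<)
open import Data.Fin.Subset using (Subset)
open import Data.Vec using (lookup)
open import Data.List using (List; foldr; map)
open import Data.List.Base using (allFin)
open import Data.Bool using (Bool; true; false; if_then_else_)
open import Data.Product using (_×_; _,_; Σ; ∃)
open import Data.Empty using (⊥)
open import Data.Unit using (⊤)
open import Relation.Nullary using (yes; no)
open import Relation.Binary.PropositionalEquality using (_≡_)

-- Parameters of the game G'_{φ,K,C}.
-- I = Fin nI, O = Fin nO (disjoint), Σ_I = Subset nI, Σ_O = Subset nO,
-- Σ_P = 2^(I ⊎ O) ≅ Σ_O × Σ_I  (the letter o ∪ i is the pair (o , i)).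
-- Q = Fin nQ.
record Setup : Set where
  field
    nI nO nQ : ℕ
    -- weight of literals: wI p true = w(p), wI p false = w(¬p)
    wI : Fin nI → Bool → ℤ
    wO : Fin nO → Bool → ℤ
    q₀ : Fin nQ
    α  : Subset nQ
    δ  : Fin nQ → Subset nO × Subset nI → Subset nQ
    K C : ℕ

module _ (G : Setup) where
  open Setup G

  ΣI-weight : Subset nI → ℤ
  ΣI-weight i = foldr ℤ._+_ (+ 0) (map (λ p → wI p (lookup i p)) (allFin nI))

  ΣO-weight : Subset nO → ℤ
  ΣO-weight o = foldr ℤ._+_ (+ 0) (map (λ p → wO p (lookup o p)) (allFin nO))

  data 𝒦 : Set where
    neg1 : 𝒦
    val  : Fin (suc K) → 𝒦
    top  : 𝒦

  data _≤𝒦_ : 𝒦 → 𝒦 → Set where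
    neg1≤   : ∀ {k} → neg1 ≤𝒦 k
    val≤val : ∀ {a b} → a Fin.≤ b → val a ≤𝒦 val b
    val≤top : ∀ {a} → val a ≤𝒦 top
    top≤top : top ≤𝒦 top

  max𝒦 : 𝒦 → 𝒦 → 𝒦
  max𝒦 neg1 k = k
  max𝒦 (val a) neg1 = val a
  max𝒦 (val a) (val b) with a Fin.≤? b
  ... | yes _ = val b
  ... | no _  = val a
  max𝒦 (val a) top = top
  max𝒦 top _ = top

  _⊕𝒦_ : 𝒦 → Bool → 𝒦
  neg1 ⊕𝒦 b = neg1
  val a ⊕𝒦 false = val a
  val a ⊕𝒦 true with suc (toℕ a) ℕ.<? suc K
  ... | yes p = val (fromℕ< p)
  ... | no _  = top
  top ⊕𝒦 b = top

  ℱ : Set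
  ℱ = Fin nQ → 𝒦

  _≤ℱ_ : ℱ → ℱ → Set
  F′ ≤ℱ F = ∀ q → F′ q ≤𝒦 F q

  F₀ : ℱ
  F₀ q with q Fin.≟ q₀
  ... | yes _ = if lookup α q₀ then (val Fin.zero ⊕𝒦 true) else val Fin.zero
  ... | no _  = neg1

  Δ : ℱ → Subset nO × Subset nI → ℱ
  Δ F σ q = foldr max𝒦 neg1
    (map (λ p → if lookup (δ p σ) q then F p ⊕𝒦 lookup α q else neg1) (allFin nQ))

  data 𝒞 : Set where
    cbot : 𝒞
    cval : Fin (suc C) → 𝒞

  data _≤𝒞_ : 𝒞 → 𝒞 → Set where
    cbot≤   : ∀ {c} → cbot ≤𝒞 c
    cval≤cval : ∀ {a b} → a Fin.≤ b → cval a ≤𝒞 cval b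

  clamp : (m n : ℕ) → Fin (suc m)
  clamp zero n = Fin.zero
  clamp (suc m) zero = Fin.zero
  clamp (suc m) (suc n) = Fin.suc (clamp m n)

  _⊕𝒞_ : 𝒞 → ℤ → 𝒞
  cbot ⊕𝒞 k = cbot
  cval c ⊕𝒞 k with (+ toℕ c) ℤ.+ k
  ... | + n = cval (clamp C n)
  ... | -[1+ _ ] = cbot

  data State : Set where
    s₁ : ℱ → Subset nI → 𝒞 → State
    s₂ : ℱ → Subset nO → 𝒞 → State

  IsS₁ : State → Set
  IsS₁ (s₁ _ _ _) = ⊤
  IsS₁ (s₂ _ _ _) = ⊥

  IsS₂ : State → Set
  IsS₂ (s₁ _ _ _) = ⊥
  IsS₂ (s₂ _ _ _) = ⊤

  initial : Subset nI → State
  initial j₀ = s₁ F₀ j₀ (cval (Fin.fromℕ C))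

  data Edge : State → State → Set where
    e₁ : ∀ F j c o → Edge (s₁ F j c) (s₂ F o (c ⊕𝒞 ΣO-weight o))
    e₂ : ∀ F o c i → Edge (s₂ F o c) (s₁ (Δ F (o , i)) i (c ⊕𝒞 ΣI-weight i))

  _⪯_ : State → State → Set
  s₁ F′ σ′ c′ ⪯ s₁ F σ c = σ′ ≡ σ × F′ ≤ℱ F × c ≤𝒞 c′
  s₂ F′ σ′ c′ ⪯ s₂ F σ c = σ′ ≡ σ × F′ ≤ℱ F × c ≤𝒞 c′
  s₁ _ _ _ ⪯ s₂ _ _ _ = ⊥
  s₂ _ _ _ ⪯ s₁ _ _ _ = ⊥

  Closed : (State → Set) → Set
  Closed L = ∀ s s′ → L s → s′ ⪯ s → L s′

  CPre₁ : (State → Set) → State → Set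
  CPre₁ L s = IsS₁ s × ∃ λ s′ → Edge s s′ × L s′

  CPre₂ : (State → Set) → State → Set
  CPre₂ L s = IsS₂ s × (∀ s′ → Edge s s′ → L s′)

-- Every ingredient of a move is monotone: the counter update c ↦ c ⊕ w, the
-- saturating increment k ↦ k ⊕ b and the max defining Δ. Hence if s′ ⪯ s,
-- every move of s is matched by a move of s′ on the same letter into a smaller
-- state, and vice versa. A witness of s ∈ CPre₁(L) thus yields one for s′, and
-- every successor of s′ lies below a successor of s, which is in L when
-- s ∈ CPre₂(L).
module Submission where

open import Defs
open import Data.Bool using (true; false; if_then_else_)
open import Data.Empty using (⊥-elim)
open import Data.Fin as Fin using (toℕ)
import Data.Fin.Properties as Finₚ
open import Data.Integer as ℤ using (ℤ; +_; -[1+_]; -≤+; +≤+)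
import Data.Integer.Properties as ℤₚ
open import Data.List using (List; []; _∷_; foldr; map; allFin)
open import Data.Nat as ℕ using (zero; suc; z≤n; s≤s)
import Data.Nat.Properties as ℕₚ
open import Data.Product using (_×_; _,_; ∃)
open import Data.Unit using (tt)
open import Data.Vec using (lookup)
open import Relation.Nullary using (yes; no)
open import Relation.Binary.PropositionalEquality using (_≡_; refl; sym; subst₂)

module _ (G : Setup) where
  open Setup G

  clamp-mono-≤ : ∀ m {a b} → a ℕ.≤ b → toℕ (clamp G m a) ℕ.≤ toℕ (clamp G m b)
  clamp-mono-≤ zero              _         = z≤n
  clamp-mono-≤ (suc m) {zero}    _         = z≤n
  clamp-mono-≤ (suc m) {suc a} {suc b} (s≤s a≤b) = s≤s (clamp-mono-≤ m a≤b)

  saturate : ℤ → 𝒞 G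
  saturate (+ n)    = cval (clamp G C n)
  saturate -[1+ _ ] = cbot

  cval-⊕𝒞 : ∀ a k → _⊕𝒞_ G (cval a) k ≡ saturate (+ toℕ a ℤ.+ k)
  cval-⊕𝒞 a k with + toℕ a ℤ.+ k
  ... | + _      = refl
  ... | -[1+ _ ] = refl

  saturate-mono-≤ : ∀ {x y} → x ℤ.≤ y → _≤𝒞_ G (saturate x) (saturate y)
  saturate-mono-≤ (ℤ.-≤- _) = cbot≤
  saturate-mono-≤ -≤+       = cbot≤
  saturate-mono-≤ (+≤+ m≤n) = cval≤cval (clamp-mono-≤ C m≤n)

  ⊕𝒞-monoˡ-≤ : ∀ {c c′} k → _≤𝒞_ G c c′ → _≤𝒞_ G (_⊕𝒞_ G c k) (_⊕𝒞_ G c′ k)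
  ⊕𝒞-monoˡ-≤ k cbot≤ = cbot≤
  ⊕𝒞-monoˡ-≤ k (cval≤cval {a} {b} a≤b)
    rewrite cval-⊕𝒞 a k | cval-⊕𝒞 b k =
    saturate-mono-≤ (ℤₚ.+-monoˡ-≤ k (+≤+ a≤b))

  ≤𝒦-refl : ∀ {a} → _≤𝒦_ G a a
  ≤𝒦-refl {neg1}  = neg1≤
  ≤𝒦-refl {val _} = val≤val Finₚ.≤-refl
  ≤𝒦-refl {top}   = top≤top

  ≤𝒦-trans : ∀ {a b c} → _≤𝒦_ G a b → _≤𝒦_ G b c → _≤𝒦_ G a c
  ≤𝒦-trans neg1≤       _           = neg1≤
  ≤𝒦-trans (val≤val p) (val≤val q) = val≤val (Finₚ.≤-trans p q)
  ≤𝒦-trans (val≤val _) val≤top     = val≤top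
  ≤𝒦-trans val≤top     top≤top     = val≤top
  ≤𝒦-trans top≤top     top≤top     = top≤top

  max𝒦-upperˡ : ∀ a b → _≤𝒦_ G a (max𝒦 G a b)
  max𝒦-upperˡ neg1    _       = neg1≤
  max𝒦-upperˡ (val _) neg1    = ≤𝒦-refl
  max𝒦-upperˡ (val a) (val b) with a Fin.≤? b
  ... | yes a≤b = val≤val a≤b
  ... | no _    = ≤𝒦-refl
  max𝒦-upperˡ (val _) top     = val≤top
  max𝒦-upperˡ top     _       = top≤top

  max𝒦-upperʳ : ∀ a b → _≤𝒦_ G b (max𝒦 G a b)
  max𝒦-upperʳ neg1    _       = ≤𝒦-refl
  max𝒦-upperʳ (val _) neg1    = neg1≤
  max𝒦-upperʳ (val a) (val b) with a Fin.≤? b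
  ... | yes _   = ≤𝒦-refl
  ... | no a≰b  = val≤val (ℕₚ.<⇒≤ (ℕₚ.≰⇒> a≰b))
  max𝒦-upperʳ (val _) top     = top≤top
  max𝒦-upperʳ top     neg1    = neg1≤
  max𝒦-upperʳ top     (val _) = val≤top
  max𝒦-upperʳ top     top     = top≤top

  max𝒦-lub : ∀ {a b c} → _≤𝒦_ G a c → _≤𝒦_ G b c → _≤𝒦_ G (max𝒦 G a b) c
  max𝒦-lub {neg1}          _   b≤c = b≤c
  max𝒦-lub {val _} {neg1}  a≤c _   = a≤c
  max𝒦-lub {val a} {val b} a≤c b≤c with a Fin.≤? b
  ... | yes _ = b≤c
  ... | no _  = a≤c
  max𝒦-lub {val _} {top}   _   b≤c = b≤c
  max𝒦-lub {top}           a≤c _   = a≤c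

  max𝒦-mono-≤ : ∀ {a a′ b b′} → _≤𝒦_ G a a′ → _≤𝒦_ G b b′ →
                _≤𝒦_ G (max𝒦 G a b) (max𝒦 G a′ b′)
  max𝒦-mono-≤ {a′ = a′} {b′ = b′} a≤a′ b≤b′ =
    max𝒦-lub (≤𝒦-trans a≤a′ (max𝒦-upperˡ a′ b′)) (≤𝒦-trans b≤b′ (max𝒦-upperʳ a′ b′))

  ⊕𝒦-monoˡ-≤ : ∀ {a a′} b → _≤𝒦_ G a a′ → _≤𝒦_ G (_⊕𝒦_ G a b) (_⊕𝒦_ G a′ b)
  ⊕𝒦-monoˡ-≤ _     neg1≤       = neg1≤
  ⊕𝒦-monoˡ-≤ false (val≤val p) = val≤val p
  ⊕𝒦-monoˡ-≤ true  (val≤val {a} {b} a≤b)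
    with suc (toℕ a) ℕ.<? suc K | suc (toℕ b) ℕ.<? suc K
  ... | yes a<K | yes b<K = val≤val (subst₂ ℕ._≤_ (sym (Finₚ.toℕ-fromℕ< a<K))
                                                  (sym (Finₚ.toℕ-fromℕ< b<K)) (s≤s a≤b))
  ... | yes _   | no _    = val≤top
  ... | no a≮K  | yes b<K = ⊥-elim (a≮K (ℕₚ.≤-trans (s≤s (s≤s a≤b)) b<K))
  ... | no _    | no _    = top≤top
  ⊕𝒦-monoˡ-≤ false val≤top     = val≤top
  ⊕𝒦-monoˡ-≤ true  (val≤top {a}) with suc (toℕ a) ℕ.<? suc K
  ... | yes _ = val≤top
  ... | no _  = top≤top
  ⊕𝒦-monoˡ-≤ _     top≤top     = top≤top

  foldr-max𝒦-mono-≤ : ∀ {A : Set} (xs : List A) {f g : A → 𝒦 G} →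
                      (∀ x → _≤𝒦_ G (f x) (g x)) →
                      _≤𝒦_ G (foldr (max𝒦 G) neg1 (map f xs)) (foldr (max𝒦 G) neg1 (map g xs))
  foldr-max𝒦-mono-≤ []       _   = neg1≤
  foldr-max𝒦-mono-≤ (x ∷ xs) f≤g = max𝒦-mono-≤ (f≤g x) (foldr-max𝒦-mono-≤ xs f≤g)

  Δ-monoˡ-≤ : ∀ {F′ F} σ → _≤ℱ_ G F′ F → _≤ℱ_ G (Δ G F′ σ) (Δ G F σ)
  Δ-monoˡ-≤ {F′} {F} σ F′≤F q = foldr-max𝒦-mono-≤ (allFin nQ) contribution-mono
    where
    contribution-mono : ∀ p →
      _≤𝒦_ G (if lookup (δ p σ) q then _⊕𝒦_ G (F′ p) (lookup α q) else neg1)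
             (if lookup (δ p σ) q then _⊕𝒦_ G (F p) (lookup α q) else neg1)
    contribution-mono p with lookup (δ p σ) q
    ... | true  = ⊕𝒦-monoˡ-≤ (lookup α q) (F′≤F p)
    ... | false = neg1≤

  Edge-⪯-forward : ∀ {s′ s t} → _⪯_ G s′ s → Edge G s t →
                   ∃ λ t′ → Edge G s′ t′ × _⪯_ G t′ t
  Edge-⪯-forward {s₁ _ _ _} (refl , F′≤F , c≤c′) (e₁ _ _ _ o) =
    _ , e₁ _ _ _ o , refl , F′≤F , ⊕𝒞-monoˡ-≤ (ΣO-weight G o) c≤c′
  Edge-⪯-forward {s₂ _ _ _} (refl , F′≤F , c≤c′) (e₂ _ o _ i) =
    _ , e₂ _ _ _ i , refl , Δ-monoˡ-≤ (o , i) F′≤F , ⊕𝒞-monoˡ-≤ (ΣI-weight G i) c≤c′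

  Edge-⪯-backward : ∀ {s′ s t′} → _⪯_ G s′ s → Edge G s′ t′ →
                    ∃ λ t → Edge G s t × _⪯_ G t′ t
  Edge-⪯-backward {s = s₁ _ _ _} (refl , F′≤F , c≤c′) (e₁ _ _ _ o) =
    _ , e₁ _ _ _ o , refl , F′≤F , ⊕𝒞-monoˡ-≤ (ΣO-weight G o) c≤c′
  Edge-⪯-backward {s = s₂ _ _ _} (refl , F′≤F , c≤c′) (e₂ _ o _ i) =
    _ , e₂ _ _ _ i , refl , Δ-monoˡ-≤ (o , i) F′≤F , ⊕𝒞-monoˡ-≤ (ΣI-weight G i) c≤c′

  IsS₁-⪯ : ∀ {s′ s} → _⪯_ G s′ s → IsS₁ G s → IsS₁ G s′
  IsS₁-⪯ {s₁ _ _ _} {s₁ _ _ _} _ _ = tt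

  IsS₂-⪯ : ∀ {s′ s} → _⪯_ G s′ s → IsS₂ G s → IsS₂ G s′
  IsS₂-⪯ {s₂ _ _ _} {s₂ _ _ _} _ _ = tt

  CPre₁-closed : ∀ {L} → Closed G L → Closed G (CPre₁ G L)
  CPre₁-closed closed s s′ (inS₁ , t , s→t , t∈L) s′⪯s
    with Edge-⪯-forward s′⪯s s→t
  ... | t′ , s′→t′ , t′⪯t = IsS₁-⪯ s′⪯s inS₁ , t′ , s′→t′ , closed t t′ t∈L t′⪯t

  CPre₂-closed : ∀ {L} → Closed G L → Closed G (CPre₂ G L)
  CPre₂-closed {L} closed s s′ (inS₂ , succ∈L) s′⪯s = IsS₂-⪯ s′⪯s inS₂ , succ′∈L
    where
    succ′∈L : ∀ t′ → Edge G s′ t′ → L t′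
    succ′∈L t′ s′→t′ with Edge-⪯-backward s′⪯s s′→t′
    ... | t , s→t , t′⪯t = closed t t′ (succ∈L t s→t) t′⪯t

lemma2 : (G : Setup) (L : State G → Set) → Closed G L → Closed G (CPre₁ G L) × Closed G (CPre₂ G L)
lemma2 G L closed = CPre₁-closed G closed , CPre₂-closed G closed
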